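{- Let $n>1$ be an integer and $m=2n$. For every $\alpha\in\{0,1,\ldots,2n\}$ there exist distinct $x_2,x_3,\ldots,x_{2n}\in S_{2n}(2n)$ such that $\alpha+\sum_{k=2}^{2n-1}x_k=(2n-1)x_{2n}$.
   Context: For an integer $m\ge3$, $S_m$ is the sequence defined greedily by $a_0=0$ and, having chosen $a_0,\ldots,a_k$, $a_{k+1}$ is the least integer greater than $a_k$ such that there are no distinct $x_1,\ldots,x_m\in\{a_0,\ldots,a_{k+1}\}$ with $x_1+\cdots+x_{m-1}=(m-1)x_m$. $S_m(k)$ denotes the set of terms of $S_m$ that are at most $k$. -}

module Defs where

open import Data.Nat using (ℕ; zero; suc; _*_)
open import Data.Fin using (Fin; inject₁; fromℕ)
open import Data.List using (List; []; _∷_; tabulate)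
open import Data.Nat.ListAction using (sum)
open import Data.List.Membership.Propositional using (_∈_)
open import Data.Product using (Σ; _×_)
open import Data.Empty using (⊥)
open import Function using (_∘_)
open import Function.Definitions using (Injective)
open import Relation.Binary.PropositionalEquality using (_≡_)
open import Relation.Nullary using (¬_)

-- HasSol m A : there are distinct x₁,…,x_m ∈ A with x₁+⋯+x_{m-1} = (m-1)·x_m.
-- For m = suc k the elements are x : Fin (suc k) → ℕ (injective = distinct),
-- x_m is the last index (fromℕ k), x₁..x_{m-1} are the indices inject₁ i.
HasSol : ℕ → List ℕ → Set
HasSol zero    A = ⊥
HasSol (suc k) A =
  Σ (Fin (suc k) → ℕ) λ x →
    Injective _≡_ _≡_ x ×
    ((i : Fin (suc k)) → x i ∈ A) ×
    (sum (tabulate (x ∘ inject₁)) ≡ k * x (fromℕ k))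

-- SUpTo m k L : L (listed in decreasing order) is the set S_m(k) of terms of the
-- greedy sequence S_m that are ≤ k.  Scanning integers upward, the greedy
-- sequence includes j exactly when adding j to the previous terms creates no
-- solution; this relation is deterministic in (m , k).
data SUpTo (m : ℕ) : ℕ → List ℕ → Set where
  base : SUpTo m 0 (0 ∷ [])
  add  : ∀ {k L} → SUpTo m k L → ¬ HasSol m (suc k ∷ L) → SUpTo m (suc k) (suc k ∷ L)
  skip : ∀ {k L} → SUpTo m k L → HasSol m (suc k ∷ L) → SUpTo m (suc k) L

-- The argument rests on one counting fact: an injective map Fin M → {0,…,M-1}
-- hits every value, so its values sum to the triangular number 0+1+⋯+(M-1).
--
--  * S_{2n}(2n) = {0,…,2n}.  A solution inside {0,…,2n} uses 2n of its 2n+1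
--    elements, omitting some e; the counting fact gives e + 2n·y = n(2n+1) for
--    the last term y, which forces e = y = n, contradicting that e is omitted.
--    Hence the greedy construction never skips a number up to 2n.
--  * For the theorem we omit two values a, b and put a third value c last.
--    The counting fact turns the required equation into a + b + 2n·c =
--    α + n(2n+1); an explicit choice of distinct a, b, c ≤ 2n solves it, and
--    the complement of {a, b}, reordered so that c comes last, is the witness.
module Submission where

open import Defs
open import Data.Nat using (ℕ; zero; suc; _*_; _+_; _∸_; _<_; _≤_; z≤n; s≤s; _≟_; _≤?_; s≤s⁻¹; z<s)
open import Data.Nat.Properties
open import Data.Nat.Tactic.RingSolver using (solve-∀)
open import Algebra.Properties.CommutativeSemigroup +-commutativeSemigroup using (x∙yz≈y∙xz)
open import Data.Fin using (Fin; zero; suc; inject₁; fromℕ; fromℕ<; toℕ; punchIn; punchOut)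
import Data.Fin.Properties as Finₚ
open import Data.Fin.Permutation.Components using (transpose; transpose-inverse)
open import Data.Vec.Functional using () renaming (_∷_ to _∷ᵥ_)
open import Data.List using (List; _∷_; tabulate; downFrom)
open import Data.List.Properties using (tabulate-cong)
open import Data.List.Membership.Propositional using (_∈_)
open import Data.List.Membership.Propositional.Properties using (∈-downFrom⁺; ∈-downFrom⁻)
open import Data.List.Relation.Binary.Subset.Propositional using (_⊆_)
open import Data.Nat.ListAction using (sum)
open import Data.Product using (Σ; _×_; _,_; ∃; proj₁; proj₂)
open import Data.Empty using (⊥-elim)
open import Function using (_∘_)
open import Function.Definitions using (Injective)
open import Relation.Binary.PropositionalEquality
open import Relation.Nullary using (¬_; yes; no; contradiction)

sum-last : ∀ N (f : Fin (suc N) → ℕ) →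
           sum (tabulate f) ≡ sum (tabulate (f ∘ inject₁)) + f (fromℕ N)
sum-last zero    f = +-comm (f zero) 0
sum-last (suc N) f = begin
  f zero + sum (tabulate (f ∘ suc))
    ≡⟨ cong (f zero +_) (sum-last N (f ∘ suc)) ⟩
  f zero + (sum (tabulate (f ∘ suc ∘ inject₁)) + f (fromℕ (suc N)))
    ≡⟨ +-assoc (f zero) _ _ ⟨
  f zero + sum (tabulate (f ∘ suc ∘ inject₁)) + f (fromℕ (suc N)) ∎
  where open ≡-Reasoning

sum-remove : ∀ N (f : Fin (suc N) → ℕ) (j : Fin (suc N)) →
             sum (tabulate f) ≡ f j + sum (tabulate (f ∘ punchIn j))
sum-remove N       f zero    = refl
sum-remove (suc N) f (suc j) = begin
  f zero + sum (tabulate (f ∘ suc))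
    ≡⟨ cong (f zero +_) (sum-remove N (f ∘ suc) j) ⟩
  f zero + (f (suc j) + sum (tabulate (f ∘ suc ∘ punchIn j)))
    ≡⟨ x∙yz≈y∙xz (f zero) (f (suc j)) _ ⟩
  f (suc j) + (f zero + sum (tabulate (f ∘ suc ∘ punchIn j))) ∎
  where open ≡-Reasoning

triangle : ℕ → ℕ
triangle M = sum (tabulate {n = M} toℕ)

triangle-suc : ∀ N → triangle (suc N) ≡ triangle N + N
triangle-suc N = trans (sum-last N toℕ)
  (cong₂ _+_ (cong sum (tabulate-cong {n = N} Finₚ.toℕ-inject₁)) (Finₚ.toℕ-fromℕ N))

triangle-odd : ∀ n → triangle (suc (2 * n)) ≡ n * suc (2 * n)
triangle-odd zero    = refl
triangle-odd (suc n) = begin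
  triangle (suc (2 * suc n))
    ≡⟨ cong (triangle ∘ suc) (2[1+n]≡2+2n n) ⟩
  triangle (suc (suc (suc (2 * n))))
    ≡⟨ triangle-suc (suc (suc (2 * n))) ⟩
  triangle (suc (suc (2 * n))) + suc (suc (2 * n))
    ≡⟨ cong (_+ suc (suc (2 * n))) (triangle-suc (suc (2 * n))) ⟩
  triangle (suc (2 * n)) + suc (2 * n) + suc (suc (2 * n))
    ≡⟨ cong (λ t → t + suc (2 * n) + suc (suc (2 * n))) (triangle-odd n) ⟩
  n * suc (2 * n) + suc (2 * n) + suc (suc (2 * n))
    ≡⟨ step n ⟩
  suc n * suc (2 * suc n) ∎
  where
  open ≡-Reasoning
  2[1+n]≡2+2n : ∀ n → 2 * suc n ≡ suc (suc (2 * n))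
  2[1+n]≡2+2n = solve-∀
  step : ∀ n → n * suc (2 * n) + suc (2 * n) + suc (suc (2 * n)) ≡ suc n * suc (2 * suc n)
  step = solve-∀

bounded-injective⇒≤ : ∀ {m n} (f : Fin m → ℕ) → Injective _≡_ _≡_ f →
                      (∀ i → f i < n) → m ≤ n
bounded-injective⇒≤ f inj bound = Finₚ.injective⇒≤ {f = f′}
  (λ {i} {j} p → inj (Finₚ.fromℕ<-injective (f i) (f j) (bound i) (bound j) p))
  where
  f′ : Fin _ → Fin _
  f′ i = fromℕ< (bound i)

top-attained : ∀ N (f : Fin (suc N) → ℕ) → Injective _≡_ _≡_ f →
               (∀ i → f i < suc N) → ∃ λ j → f j ≡ N
top-attained N f inj bound with Finₚ.any? (λ j → f j ≟ N)
... | yes attained = attained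
... | no missed    = contradiction (bounded-injective⇒≤ f inj below) (<-irrefl refl)
  where
  below : ∀ i → f i < N
  below i = ≤∧≢⇒< (s≤s⁻¹ (bound i)) (λ fi≡N → missed (i , fi≡N))

-- The counting fact: an injective map Fin M → {0,…,M-1} is a permutation of
-- {0,…,M-1}, so its values sum to the triangular number.
sum-injective-bounded : ∀ M (f : Fin M → ℕ) → Injective _≡_ _≡_ f →
                        (∀ i → f i < M) → sum (tabulate f) ≡ triangle M
sum-injective-bounded zero    f inj bound = refl
sum-injective-bounded (suc N) f inj bound = begin
  sum (tabulate f)                      ≡⟨ sum-remove N f j ⟩
  f j + sum (tabulate (f ∘ punchIn j))  ≡⟨ cong₂ _+_ fj≡N (sum-injective-bounded N _ inj′ bound′) ⟩
  N + triangle N                        ≡⟨ +-comm N (triangle N) ⟩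
  triangle N + N                        ≡⟨ triangle-suc N ⟨
  triangle (suc N)                      ∎
  where
  open ≡-Reasoning
  j = proj₁ (top-attained N f inj bound)
  fj≡N = proj₂ (top-attained N f inj bound)
  inj′ : Injective _≡_ _≡_ (f ∘ punchIn j)
  inj′ p = Finₚ.punchIn-injective j _ _ (inj p)
  bound′ : ∀ i → f (punchIn j i) < N
  bound′ i = ≤∧≢⇒< (s≤s⁻¹ (bound (punchIn j i)))
    (λ fi≡N → Finₚ.punchInᵢ≢i j i (inj (trans fi≡N (sym fj≡N))))

missing-value : ∀ {M} (x : Fin M → ℕ) → ∃ λ e → e < suc M × (∀ i → x i ≢ e)
missing-value {M} x with Finₚ.all? (λ (v : Fin (suc M)) → Finₚ.any? (λ i → x i ≟ toℕ v))
... | yes hit = contradiction (Finₚ.injective⇒≤ preimage-injective) (<-irrefl refl)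
  where
  preimage : Fin (suc M) → Fin M
  preimage v = proj₁ (hit v)
  preimage-injective : Injective _≡_ _≡_ preimage
  preimage-injective {v} {w} p = Finₚ.toℕ-injective
    (trans (sym (proj₂ (hit v))) (trans (cong x p) (proj₂ (hit w))))
... | no ¬hit with Finₚ.¬∀⟶∃¬ (suc M) _ (λ v → Finₚ.any? (λ i → x i ≟ toℕ v)) ¬hit
...   | v , missed = toℕ v , Finₚ.toℕ<n v , λ i xi≡v → missed (i , xi≡v)

cons-injective : ∀ {A : Set} {n} {v : A} {f : Fin n → A} →
                 (∀ i → f i ≢ v) → Injective _≡_ _≡_ f → Injective _≡_ _≡_ (v ∷ᵥ f)
cons-injective fresh inj {zero}  {zero}  _ = refl
cons-injective fresh inj {zero}  {suc j} p = ⊥-elim (fresh j (sym p))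
cons-injective fresh inj {suc i} {zero}  p = ⊥-elim (fresh i p)
cons-injective fresh inj {suc i} {suc j} p = cong suc (inj p)

module Complement₂ {K : ℕ} {a b : Fin (suc (suc K))} (a≢b : a ≢ b) where

  b′ : Fin (suc K)
  b′ = punchOut a≢b

  skip₂ : Fin K → Fin (suc (suc K))
  skip₂ = punchIn a ∘ punchIn b′

  skip₂-injective : Injective _≡_ _≡_ skip₂
  skip₂-injective p = Finₚ.punchIn-injective b′ _ _ (Finₚ.punchIn-injective a _ _ p)

  skip₂-avoids-a : ∀ i → skip₂ i ≢ a
  skip₂-avoids-a i = Finₚ.punchInᵢ≢i a _

  skip₂-avoids-b : ∀ i → skip₂ i ≢ b
  skip₂-avoids-b i p = Finₚ.punchInᵢ≢i b′ i
    (Finₚ.punchIn-injective a _ _ (trans p (sym (Finₚ.punchIn-punchOut a≢b))))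

  skip₂-onto : ∀ {c} → c ≢ a → c ≢ b → ∃ λ j → skip₂ j ≡ c
  skip₂-onto {c} c≢a c≢b = punchOut b′≢c′ , (begin
    punchIn a (punchIn b′ (punchOut b′≢c′)) ≡⟨ cong (punchIn a) (Finₚ.punchIn-punchOut b′≢c′) ⟩
    punchIn a c′                            ≡⟨ Finₚ.punchIn-punchOut a≢c ⟩
    c                                       ∎)
    where
    open ≡-Reasoning
    a≢c : a ≢ c
    a≢c = c≢a ∘ sym
    c′ : Fin (suc K)
    c′ = punchOut a≢c
    b′≢c′ : b′ ≢ c′
    b′≢c′ p = c≢b (begin
      c             ≡⟨ Finₚ.punchIn-punchOut a≢c ⟨
      punchIn a c′  ≡⟨ cong (punchIn a) p ⟨
      punchIn a b′  ≡⟨ Finₚ.punchIn-punchOut a≢b ⟩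
      b             ∎)

transpose-first : ∀ {n} (i j : Fin n) → transpose i j i ≡ j
transpose-first i j with i Finₚ.≟ i
... | yes _   = refl
... | no i≢i = contradiction refl i≢i

transpose-injective : ∀ {n} (i j : Fin n) → Injective _≡_ _≡_ (transpose i j)
transpose-injective i j p =
  trans (sym (transpose-inverse j i)) (trans (cong (transpose j i) p) (transpose-inverse j i))

-- Given distinct a, b, c ≤ K+2, the K+1 numbers of {0,…,K+2} other than a and b,
-- listed with c last; the counting fact records their total.
record Omitting (K a b c : ℕ) : Set where
  field
    x         : Fin (suc K) → ℕ
    injective : Injective _≡_ _≡_ x
    bounded   : ∀ i → x i < suc (suc (suc K))
    last≡c    : x (fromℕ K) ≡ c
    total     : a + (b + (sum (tabulate (x ∘ inject₁)) + c)) ≡ triangle (suc (suc (suc K)))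

omit-two : ∀ K {a b c} → a < suc (suc (suc K)) → b < suc (suc (suc K)) → c < suc (suc (suc K)) →
           a ≢ b → c ≢ a → c ≢ b → Omitting K a b c
omit-two K {a} {b} {c} a< b< c< a≢b c≢a c≢b = record
  { x = toℕ ∘ W ; injective = λ p → W-injective (Finₚ.toℕ-injective p) ; bounded = Finₚ.toℕ<n ∘ W
  ; last≡c = last≡c ; total = total }
  where
  open ≡-Reasoning
  fin : ∀ {v} → v < suc (suc (suc K)) → Fin (suc (suc (suc K)))
  fin v< = fromℕ< v<
  distinct : ∀ {u v} (u< : u < suc (suc (suc K))) (v< : v < suc (suc (suc K))) → u ≢ v → fin u< ≢ fin v<
  distinct u< v< u≢v = u≢v ∘ Finₚ.fromℕ<-injective _ _ u< v<
  open Complement₂ (distinct a< b< a≢b)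
  j = proj₁ (skip₂-onto (distinct c< a< c≢a) (distinct c< b< c≢b))
  skip₂j≡c = proj₂ (skip₂-onto (distinct c< a< c≢a) (distinct c< b< c≢b))
  -- the complement of {a, b}, reordered so that c comes last
  W : Fin (suc K) → Fin (suc (suc (suc K)))
  W = skip₂ ∘ transpose (fromℕ K) j
  W-injective : Injective _≡_ _≡_ W
  W-injective p = transpose-injective (fromℕ K) j (skip₂-injective p)
  last≡c : toℕ (W (fromℕ K)) ≡ c
  last≡c = begin
    toℕ (skip₂ (transpose (fromℕ K) j (fromℕ K))) ≡⟨ cong (toℕ ∘ skip₂) (transpose-first (fromℕ K) j) ⟩
    toℕ (skip₂ j)                                  ≡⟨ cong toℕ skip₂j≡c ⟩
    toℕ (fin c<)                                   ≡⟨ Finₚ.toℕ-fromℕ< c< ⟩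
    c                                              ∎
  -- a, b followed by the complement enumerate all of Fin (K+3) injectively
  everything : Fin (suc (suc (suc K))) → Fin (suc (suc (suc K)))
  everything = fin a< ∷ᵥ (fin b< ∷ᵥ W)
  everything-injective : Injective _≡_ _≡_ everything
  everything-injective = cons-injective avoids-a (cons-injective (skip₂-avoids-b ∘ transpose (fromℕ K) j) W-injective)
    where
    avoids-a : ∀ i → (fin b< ∷ᵥ W) i ≢ fin a<
    avoids-a zero    = distinct a< b< a≢b ∘ sym
    avoids-a (suc i) = skip₂-avoids-a _
  total : a + (b + (sum (tabulate (toℕ ∘ W ∘ inject₁)) + c)) ≡ triangle (suc (suc (suc K)))
  total = begin
    a + (b + (sum (tabulate (toℕ ∘ W ∘ inject₁)) + c))
      ≡⟨ cong (λ t → a + (b + (sum (tabulate (toℕ ∘ W ∘ inject₁)) + t))) last≡c ⟨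
    a + (b + (sum (tabulate (toℕ ∘ W ∘ inject₁)) + toℕ (W (fromℕ K))))
      ≡⟨ cong (λ t → a + (b + t)) (sum-last K (toℕ ∘ W)) ⟨
    a + (b + sum (tabulate (toℕ ∘ W)))
      ≡⟨ cong₂ (λ u v → u + (v + sum (tabulate (toℕ ∘ W)))) (Finₚ.toℕ-fromℕ< a<) (Finₚ.toℕ-fromℕ< b<) ⟨
    sum (tabulate (toℕ ∘ everything))
      ≡⟨ sum-injective-bounded _ (toℕ ∘ everything) (λ p → everything-injective (Finₚ.toℕ-injective p)) (Finₚ.toℕ<n ∘ everything) ⟩
    triangle (suc (suc (suc K))) ∎

n<2n : ∀ {n} → 0 < n → n < 2 * n
n<2n {n} n>0 = m<m+n n (≤-trans n>0 (m≤m+n n 0))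

n+n≡2n : ∀ n → n + n ≡ 2 * n
n+n≡2n n = cong (n +_) (sym (+-identityʳ n))

-- The only way to write n(2n+1) as e + 2n·y with e ≤ 2n is e = y = n:
-- comparing with the multiples 2n·n and 2n·(n+1) pins y down.
centre : ∀ {n e y} → 0 < n → e ≤ 2 * n → e + 2 * n * y ≡ n * suc (2 * n) → e ≡ n × y ≡ n
centre {n} {e} {y} n>0 e≤2n balanced = e≡n , y≡n
  where
  open ≤-Reasoning
  balanced′ : e + 2 * n * y ≡ n + 2 * n * n
  balanced′ = trans balanced (expand n)
    where
    expand : ∀ n → n * suc (2 * n) ≡ n + 2 * n * n
    expand = solve-∀
  y<1+n : y < suc n
  y<1+n = *-cancelˡ-< (2 * n) y (suc n) (begin-strict
    2 * n * y          ≤⟨ m≤n+m _ e ⟩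
    e + 2 * n * y      ≡⟨ balanced′ ⟩
    n + 2 * n * n      <⟨ +-monoˡ-< (2 * n * n) (n<2n n>0) ⟩
    2 * n + 2 * n * n  ≡⟨ *-suc (2 * n) n ⟨
    2 * n * suc n      ∎)
  n<1+y : n < suc y
  n<1+y = *-cancelˡ-< (2 * n) n (suc y) (begin-strict
    2 * n * n          <⟨ m<n+m _ n>0 ⟩
    n + 2 * n * n      ≡⟨ balanced′ ⟨
    e + 2 * n * y      ≤⟨ +-monoˡ-≤ (2 * n * y) e≤2n ⟩
    2 * n + 2 * n * y  ≡⟨ *-suc (2 * n) y ⟨
    2 * n * suc y      ∎)
  y≡n : y ≡ n
  y≡n = ≤-antisym (s≤s⁻¹ y<1+n) (s≤s⁻¹ n<1+y)
  e≡n : e ≡ n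
  e≡n = +-cancelʳ-≡ (2 * n * n) e n (subst (λ t → e + 2 * n * t ≡ n + 2 * n * n) y≡n balanced′)

record Choice (n α : ℕ) : Set where
  field
    a b c   : ℕ
    a≤      : a ≤ 2 * n
    b≤      : b ≤ 2 * n
    c≤      : c ≤ 2 * n
    a≢b     : a ≢ b
    c≢a     : c ≢ a
    c≢b     : c ≢ b
    balance : a + b + 2 * n * c ≡ α + n * suc (2 * n)

choose : ∀ n → 0 < n → ∀ α → α ≤ 2 * n → Choice n α
choose n@(suc m) _ zero _ = record
  { a = n ; b = 2 * n ; c = m
  ; a≤ = n≤2n ; b≤ = ≤-refl ; c≤ = ≤-trans (n≤1+n m) n≤2n
  ; a≢b = <⇒≢ (n<2n z<s) ; c≢a = <⇒≢ (n<1+n m) ; c≢b = <⇒≢ (<-≤-trans (n<1+n m) n≤2n)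
  ; balance = identity m }
  where
  n≤2n : n ≤ 2 * n
  n≤2n = m≤m+n n _
  identity : ∀ m → suc m + 2 * suc m + 2 * suc m * m ≡ 0 + suc m * suc (2 * suc m)
  identity = solve-∀
choose n n>0 (suc α) α≤2n with suc α ≤? n
... | yes α≤n = record
  { a = 0 ; b = suc α + n ; c = n
  ; a≤ = z≤n ; b≤ = subst (suc α + n ≤_) (n+n≡2n n) (+-monoˡ-≤ n α≤n) ; c≤ = m≤m+n n _
  ; a≢b = λ () ; c≢a = <⇒≢ n>0 ∘ sym ; c≢b = <⇒≢ (m<n+m n z<s)
  ; balance = identity α n }
  where
  identity : ∀ α n → 0 + (suc α + n) + 2 * n * n ≡ suc α + n * suc (2 * n)
  identity = solve-∀
... | no α≰n with suc α ≟ 2 * n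
...   | yes α≡2n = record
  { a = 0 ; b = n ; c = suc n
  ; a≤ = z≤n ; b≤ = m≤m+n n _ ; c≤ = subst (suc n ≤_) (n+n≡2n n) (+-monoˡ-≤ n n>0)
  ; a≢b = <⇒≢ n>0 ; c≢a = λ () ; c≢b = <⇒≢ (n<1+n n) ∘ sym
  ; balance = trans (identity n) (cong (_+ n * suc (2 * n)) (sym α≡2n)) }
  where
  identity : ∀ n → 0 + n + 2 * n * suc n ≡ 2 * n + n * suc (2 * n)
  identity = solve-∀
...   | no α≢2n = record
  { a = d ; b = 2 * n ; c = n
  ; a≤ = ≤-trans (<⇒≤ d<n) (m≤m+n n _) ; b≤ = ≤-refl ; c≤ = m≤m+n n _
  ; a≢b = <⇒≢ (<-≤-trans d<n (m≤m+n n _)) ; c≢a = <⇒≢ d<n ∘ sym ; c≢b = <⇒≢ (n<2n n>0)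
  ; balance = trans (identity d n) (cong (_+ n * suc (2 * n)) n+d≡α) }
  where
  d = suc α ∸ n
  n+d≡α : n + d ≡ suc α
  n+d≡α = m+[n∸m]≡n (<⇒≤ (≰⇒> α≰n))
  d<n : d < n
  d<n = +-cancelˡ-< n d n (subst₂ _<_ (sym n+d≡α) (sym (n+n≡2n n)) (≤∧≢⇒< α≤2n α≢2n))
  identity : ∀ d n → d + 2 * n + 2 * n * n ≡ (n + d) + n * suc (2 * n)
  identity = solve-∀

rebalance : ∀ {α S a b c K T} → a + (b + (S + c)) ≡ T → a + b + suc (suc K) * c ≡ α + T →
            α + S ≡ suc K * c
rebalance {α} {S} {a} {b} {c} {K} {T} total balance = +-cancelʳ-≡ (a + b + c) _ _ (begin
  α + S + (a + b + c)        ≡⟨ regroup α S a b c ⟩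
  α + (a + (b + (S + c)))    ≡⟨ cong (α +_) total ⟩
  α + T                      ≡⟨ balance ⟨
  a + b + suc (suc K) * c    ≡⟨ split a b c K ⟩
  suc K * c + (a + b + c)    ∎)
  where
  open ≡-Reasoning
  regroup : ∀ α S a b c → α + S + (a + b + c) ≡ α + (a + (b + (S + c)))
  regroup = solve-∀
  split : ∀ a b c K → a + b + suc (suc K) * c ≡ suc K * c + (a + b + c)
  split = solve-∀

HasSol-mono : ∀ m {A B} → A ⊆ B → HasSol m A → HasSol m B
HasSol-mono (suc k) A⊆B (x , injective , x∈A , balanced) = x , injective , (λ i → A⊆B (x∈A i)) , balanced

greedy-takes-all : ∀ {m k L} → ¬ HasSol m (downFrom (suc m)) → SUpTo m k L → k ≤ m →
                   L ≡ downFrom (suc k)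
greedy-takes-all none base        _   = refl
greedy-takes-all none (add S _)   k<m = cong (_ ∷_) (greedy-takes-all none S (<⇒≤ k<m))
greedy-takes-all {m} none (skip {k} S sol) k<m = contradiction (HasSol-mono m within solution) none
  where
  solution : HasSol m (downFrom (suc (suc k)))
  solution = subst (λ L → HasSol m (suc k ∷ L)) (greedy-takes-all none S (<⇒≤ k<m)) sol
  within : downFrom (suc (suc k)) ⊆ downFrom (suc m)
  within v∈ = ∈-downFrom⁺ (<-≤-trans (∈-downFrom⁻ v∈) (s≤s k<m))

-- {0,…,2n} contains no solution for m = 2n: a solution uses all but one value e,
-- and the counting fact gives e + 2n·y = n(2n+1) for the last term y, so e = y.
no-solution-in-range : ∀ n → 0 < n → ¬ HasSol (2 * n) (downFrom (suc (2 * n)))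
no-solution-in-range n@(suc _) n>0 (x , x-injective , x∈range , balanced) =
  fresh (fromℕ k) (trans y≡n (sym e≡n))
  where
  open ≡-Reasoning
  k = 2 * n ∸ 1
  y = x (fromℕ k)
  missing = missing-value x
  e = proj₁ missing
  e<1+2n = proj₁ (proj₂ missing)
  fresh = proj₂ (proj₂ missing)
  bounded : ∀ i → (e ∷ᵥ x) i < suc (2 * n)
  bounded zero    = e<1+2n
  bounded (suc i) = ∈-downFrom⁻ (x∈range i)
  sum-x : sum (tabulate x) ≡ 2 * n * y
  sum-x = begin
    sum (tabulate x)                  ≡⟨ sum-last k x ⟩
    sum (tabulate (x ∘ inject₁)) + y  ≡⟨ cong (_+ y) balanced ⟩
    k * y + y                         ≡⟨ +-comm (k * y) y ⟩
    2 * n * y                         ∎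
  e+2ny : e + 2 * n * y ≡ n * suc (2 * n)
  e+2ny = begin
    e + 2 * n * y             ≡⟨ cong (e +_) sum-x ⟨
    sum (tabulate (e ∷ᵥ x))   ≡⟨ sum-injective-bounded _ (e ∷ᵥ x) (cons-injective fresh x-injective) bounded ⟩
    triangle (suc (2 * n))    ≡⟨ triangle-odd n ⟩
    n * suc (2 * n)           ∎
  e≡n = proj₁ (centre n>0 (s≤s⁻¹ e<1+2n) e+2ny)
  y≡n = proj₂ (centre n>0 (s≤s⁻¹ e<1+2n) e+2ny)

-- Since S_{2n}(2n) = {0,…,2n}, the complement of {a, b} with c last lies in it,
-- and the two balances combine to the required equation.
lemma10 : (n : ℕ) → 1 < n → (L : List ℕ) → SUpTo (2 * n) (2 * n) L →
    (α : ℕ) → α ≤ 2 * n →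
    Σ (Fin (suc (2 * n ∸ 2)) → ℕ) λ x →
      Injective _≡_ _≡_ x ×
      ((i : Fin (suc (2 * n ∸ 2))) → x i ∈ L) ×
      (α + sum (tabulate (x ∘ inject₁)) ≡ (2 * n ∸ 1) * x (fromℕ (2 * n ∸ 2)))
lemma10 n@(suc (suc _)) (s≤s (s≤s z≤n)) L greedy α α≤2n = x , injective , x∈L , equation
  where
  n>0 : 0 < n
  n>0 = z<s
  L≡range : L ≡ downFrom (suc (2 * n))
  L≡range = greedy-takes-all (no-solution-in-range n n>0) greedy ≤-refl
  open Choice (choose n n>0 α α≤2n)
  open Omitting (omit-two (2 * n ∸ 2) (s≤s a≤) (s≤s b≤) (s≤s c≤) a≢b c≢a c≢b)
  x∈L : ∀ i → x i ∈ L
  x∈L i = subst (x i ∈_) (sym L≡range) (∈-downFrom⁺ (bounded i))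
  equation : α + sum (tabulate (x ∘ inject₁)) ≡ (2 * n ∸ 1) * x (fromℕ (2 * n ∸ 2))
  equation = begin
    α + sum (tabulate (x ∘ inject₁))  ≡⟨ rebalance {a = a} {b} {c} {2 * n ∸ 2} total (trans balance (cong (α +_) (sym (triangle-odd n)))) ⟩
    (2 * n ∸ 1) * c                   ≡⟨ cong ((2 * n ∸ 1) *_) last≡c ⟨
    (2 * n ∸ 1) * x (fromℕ (2 * n ∸ 2)) ∎
    where open ≡-Reasoning
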